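{- Let $n\ge6$ and let $Q_n$, $P_n$, $c_{P_n}$, $\mu_{P_n}$ be as in the context. Then there exist positive real numbers $\alpha_v$, indexed by the vertices $v$ of $P_n$, such that $\sum_{v}\alpha_v\,\mathrm{ev}_v=\mathrm{ev}_{c_{P_n}}+\frac{\mu_{P_n}}{n}Q_n^{ -1}$ in the space of quadratic functions; i.e. the quadratic function $f_n(x)=Q_n[x-c_{P_n}]-\mu_{P_n}$ associated with $P_n$ is (inhomogeneous) eutactic.
   Context: $Q_n$ is the diagonal form $Q_n[x]=x_1^2+\dots+x_{n-1}^2+\frac{n-3}{4}x_n^2$ for $n$ even and $x_1^2+\dots+x_{n-1}^2+\frac{n-5}{4}x_n^2$ for $n$ odd. Write $((1/2)^{n-1},a)$ for the vector in $\mathbb{R}^n$ with first $n-1$ coordinates $1/2$ and last coordinate $a$, $e_i$ for standard basis vectors, and $\frac12H_{n-1}=\{x\in\{0,1\}^{n-1}:\sum x_i\text{ even}\}$. For $n$ even, $P_n$ is the convex hull of $((1/2)^{n-1},1)\pm e_i$ ($i=1,\dots,n-1$), $((1/2)^{n-1},-1)$, and $(h,0)$ for $h\in\frac12H_{n-1}$; $c_{P_n}=((1/2)^{n-1},1/(n-3))$, $\mu_{P_n}=(n-2)^2/(4(n-3))$. For $n$ odd, $P_n$ is the convex hull of $((1/2)^{n-1},\pm1)\pm e_i$ ($i=1,\dots,n-1$, all sign choices) and $(h,0)$, $h\in\frac12H_{n-1}$; $c_{P_n}=((1/2)^{n-1},0)$, $\mu_{P_n}=(n-1)/4$. Quadratic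 functions $f(x)=\alpha_f+2b_f\cdot x+Q_f[x]$ form a vector space; a symmetric matrix $M$ is identified with the quadratic function $x\mapsto x^tMx$, and $\mathrm{ev}_x$ is the quadratic function $y\mapsto(1+x\cdot y)^2$. -}

module Defs where

open import Data.Bool using (Bool; true; false; if_then_else_; not)
open import Data.Nat as ℕ using (ℕ; zero; suc; _∸_; _≡ᵇ_)
open import Data.Integer as ℤ using (ℤ; +_)
open import Data.Fin using (Fin; toℕ)
open import Data.List using (List; []; _∷_; map; foldr; _++_; concatMap; filter; allFin; length; lookup)
open import Data.Rational using (ℚ; 0ℚ; 1ℚ; _+_; _*_; _-_; -_; _/_)
open import Relation.Nullary.Decidable using (does)
open import Relation.Binary.PropositionalEquality using (_≡_)

Vec : ℕ → Set
Vec n = Fin n → ℚ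

QF : ℕ → Set
QF n = Vec n → ℚ

Σℚ : List ℚ → ℚ
Σℚ = foldr _+_ 0ℚ

dot : ∀ {n} → Vec n → Vec n → ℚ
dot {n} x y = Σℚ (map (λ i → x i * y i) (allFin n))

matQF : ∀ {n} → (Fin n → Fin n → ℚ) → QF n
matQF {n} M x = Σℚ (map (λ i → Σℚ (map (λ j → x i * M i j * x j) (allFin n))) (allFin n))

ev : ∀ {n} → Vec n → QF n
ev x y = (1ℚ + dot x y) * (1ℚ + dot x y)

-- p / d as a rational, with the convention p / 0 = 0 (only used with d > 0)
frac : ℤ → ℕ → ℚ
frac p zero = 0ℚ
frac p (suc d) = p / suc d

isEven : ℕ → Bool
isEven zero = true
isEven (suc n) = not (isEven n)

half : ℚ
half = + 1 / 2

point : ∀ n → (ℕ → ℚ) → ℚ → Vec n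
point n f a i = if toℕ i ≡ᵇ (n ∸ 1) then a else f (toℕ i)

halfPt : ∀ n → ℚ → Vec n
halfPt n a = point n (λ _ → half) a

halfPtShift : ∀ n → ℚ → ℕ → ℚ → Vec n
halfPtShift n a i s = point n (λ j → if j ≡ᵇ i then half + s else half) a

bits : ℕ → List (List Bool)
bits zero = [] ∷ []
bits (suc k) = map (false ∷_) (bits k) ++ map (true ∷_) (bits k)

countTrue : List Bool → ℕ
countTrue [] = 0
countTrue (true ∷ bs) = suc (countTrue bs)
countTrue (false ∷ bs) = countTrue bs

evenBits : List Bool → Bool
evenBits bs = isEven (countTrue bs)

filterB : ∀ {A : Set} → (A → Bool) → List A → List A
filterB p [] = []
filterB p (x ∷ xs) = if p x then x ∷ filterB p xs else filterB p xs

halfCube : ℕ → List (List Bool)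
halfCube k = filterB evenBits (bits k)

bitAt : List Bool → ℕ → ℚ
bitAt [] _ = 0ℚ
bitAt (b ∷ bs) zero = if b then 1ℚ else 0ℚ
bitAt (b ∷ bs) (suc j) = bitAt bs j

cubePts : ∀ n → List (Vec n)
cubePts n = map (λ h → point n (bitAt h) 0ℚ) (halfCube (n ∸ 1))

indices : ℕ → List ℕ
indices zero = []
indices (suc k) = indices k ++ (k ∷ [])

vertsEven : ∀ n → List (Vec n)
vertsEven n =
  concatMap (λ i → halfPtShift n 1ℚ i 1ℚ ∷ halfPtShift n 1ℚ i (- 1ℚ) ∷ []) (indices (n ∸ 1))
  ++ (halfPt n (- 1ℚ) ∷ [])
  ++ cubePts n

vertsOdd : ∀ n → List (Vec n)
vertsOdd n =
  concatMap (λ i → halfPtShift n 1ℚ i 1ℚ ∷ halfPtShift n 1ℚ i (- 1ℚ)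
                 ∷ halfPtShift n (- 1ℚ) i 1ℚ ∷ halfPtShift n (- 1ℚ) i (- 1ℚ) ∷ []) (indices (n ∸ 1))
  ++ cubePts n

verts : ∀ n → List (Vec n)
verts n = if isEven n then vertsEven n else vertsOdd n

centre : ∀ n → Vec n
centre n = if isEven n then halfPt n (frac (+ 1) (n ∸ 3)) else halfPt n 0ℚ

μ : ℕ → ℚ
μ n = if isEven n then frac (+ ((n ∸ 2) ℕ.* (n ∸ 2))) (4 ℕ.* (n ∸ 3))
                  else frac (+ (n ∸ 1)) 4

qLast : ℕ → ℚ
qLast n = if isEven n then frac (+ (n ∸ 3)) 4 else frac (+ (n ∸ 5)) 4

Qmat : ∀ n → Fin n → Fin n → ℚ
Qmat n i j = if toℕ i ≡ᵇ toℕ j then (if toℕ i ≡ᵇ (n ∸ 1) then qLast n else 1ℚ) else 0ℚ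

qInvLast : ℕ → ℚ
qInvLast n = if isEven n then frac (+ 4) (n ∸ 3) else frac (+ 4) (n ∸ 5)

QinvMat : ∀ n → Fin n → Fin n → ℚ
QinvMat n i j = if toℕ i ≡ᵇ toℕ j then (if toℕ i ≡ᵇ (n ∸ 1) then qInvLast n else 1ℚ) else 0ℚ

-- Weight every vertex of P_n by its layer x_n ∈ {1, −1, 0} and write y = (z, t), with S = Σ zᵢ
-- and Q = Σ zᵢ². Over the vertices ((1/2)^{n−1}, ±1) ± eᵢ the terms linear in zᵢ cancel,
-- leaving multiples of (1 + S/2 ± t)² and of Q. Over the half cube (1/2)H_m, m = n − 1, one has
-- Σ (1 + h·z)² = 2^{m−3} (4 + 4S + S² + Q): induct on m ≥ 3, splitting on the first bit,
-- which exchanges the even and the odd half. Both sides of the identity are therefore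
-- combinations of (1 + S/2)², t (2 + S), t² and Q, and matching the four coefficients is a
-- linear system in the layer weights. Its solution is an explicit positive rational function
-- of n, verified by clearing denominators and normalising polynomials in k = n − 6.

module Submission where

open import Defs
open import Data.Nat using (ℕ; _≤_)
open import Data.Integer using (+_)
open import Data.Fin using (Fin)
open import Data.List using (List; map; allFin; length; lookup)
open import Data.Rational using (ℚ; 0ℚ; _<_; _+_; _*_)
open import Data.Product using (Σ; _×_)
open import Relation.Binary.PropositionalEquality using (_≡_)

open import Algebra.Bundles using (CommutativeRing)
open import Data.Bool using (Bool; true; false; if_then_else_; not)
open import Data.Bool.Properties using (not-involutive)
open import Data.Fin using (zero; suc; toℕ; fromℕ; inject₁)
open import Data.Fin.Properties using (toℕ-inject₁; toℕ-fromℕ)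
open import Data.List using ([]; _∷_; _++_; tabulate; concatMap)
open import Data.List.Properties using (map-++; map-∘; map-cong; map-tabulate)
open import Data.Nat as ℕ using (zero; suc; _≡ᵇ_; s≤s; z≤n)
import Data.Nat.Solver as ℕ-Solver
import Data.Integer as ℤ
import Data.Integer.Properties as ℤ
import Data.Nat.Properties as ℕₚ
open import Data.Product using (_,_; proj₁; proj₂)
open import Data.Rational using (1ℚ; -_; _/_; fromℚᵘ; toℚᵘ; Positive)
open import Data.Rational.Properties as ℚ
  using (fromℚᵘ-cong; toℚᵘ-fromℚᵘ; fromℚᵘ-toℚᵘ; toℚᵘ-homo-+; toℚᵘ-homo-*; _≟_;
         +-*-commutativeRing; normalize-pos; pos*pos⇒pos; positive⁻¹)
import Data.Rational.Solver as ℚ-Solver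
import Data.Rational.Unnormalised as ℚᵘ
import Data.Rational.Unnormalised.Properties as ℚᵘ
open import Data.Vec using ([]; _∷_)
open import Function using (_∘_; id)
open import Relation.Nullary.Decidable using (does)
open import Relation.Binary.PropositionalEquality
  using (refl; sym; trans; cong; cong₂; module ≡-Reasoning)

open import Algebra.Properties.Semiring.Sum (CommutativeRing.semiring +-*-commutativeRing)
  using (sum; sum-syntax; sum-cong-≗; ∑-distrib-+; *-distribˡ-sum; sum-init-last)
open import Algebra.Properties.Semiring.Exp (CommutativeRing.semiring +-*-commutativeRing)
  using (_^_)

open ≡-Reasoning

private variable A B : Set

-- Rational functions of one natural parameter

module ℕ-Poly = ℕ-Solver.+-*-Solver
open ℕ-Poly using () renaming (con to infix 10 #_; _:+_ to infixl 7 _⊞_; _:*_ to infixl 8 _⊠_)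

Poly : Set
Poly = ℕ-Poly.Polynomial 1

X : Poly
X = ℕ-Poly.var zero

infix 8 _at_
_at_ : Poly → ℕ → ℕ
p at k = ℕ-Poly.⟦ p ⟧ (k ∷ [])

infixl 6 _⊕_
infixl 7 _⊗_
infix 8 _/1+_
infix 9 `_ 1/1+_

-- p /1+ q denotes p / (1 + q); denominators are positive by construction.
data RatFun : Set where
  _/1+_ : Poly → Poly → RatFun
  _⊕_ _⊗_ : RatFun → RatFun → RatFun

`_ : Poly → RatFun
` p = p /1+ # 0

1/1+_ : Poly → RatFun
1/1+ q = # 1 /1+ q

eval : RatFun → ℕ → ℚ
eval (p /1+ q) k = + (p at k) / suc (q at k)
eval (e ⊕ f)   k = eval e k + eval f k
eval (e ⊗ f)   k = eval e k * eval f k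

num den : RatFun → Poly
num (p /1+ q) = p
num (e ⊕ f)   = num e ⊠ (# 1 ⊞ den f) ⊞ num f ⊠ (# 1 ⊞ den e)
num (e ⊗ f)   = num e ⊠ num f
den (p /1+ q) = q
den (e ⊕ f)   = den f ⊞ den e ⊠ (# 1 ⊞ den f)
den (e ⊗ f)   = den f ⊞ den e ⊠ (# 1 ⊞ den f)

fromℚᵘ-homo-+ : ∀ p q → fromℚᵘ (p ℚᵘ.+ q) ≡ fromℚᵘ p + fromℚᵘ q
fromℚᵘ-homo-+ p q = begin
  fromℚᵘ (p ℚᵘ.+ q)
    ≡⟨ fromℚᵘ-cong (ℚᵘ.+-cong (ℚᵘ.≃-sym (toℚᵘ-fromℚᵘ p)) (ℚᵘ.≃-sym (toℚᵘ-fromℚᵘ q))) ⟩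
  fromℚᵘ (toℚᵘ (fromℚᵘ p) ℚᵘ.+ toℚᵘ (fromℚᵘ q))
    ≡⟨ fromℚᵘ-cong (ℚᵘ.≃-sym (toℚᵘ-homo-+ (fromℚᵘ p) (fromℚᵘ q))) ⟩
  fromℚᵘ (toℚᵘ (fromℚᵘ p + fromℚᵘ q))           ≡⟨ fromℚᵘ-toℚᵘ _ ⟩
  fromℚᵘ p + fromℚᵘ q                           ∎

fromℚᵘ-homo-* : ∀ p q → fromℚᵘ (p ℚᵘ.* q) ≡ fromℚᵘ p * fromℚᵘ q
fromℚᵘ-homo-* p q = begin
  fromℚᵘ (p ℚᵘ.* q)
    ≡⟨ fromℚᵘ-cong (ℚᵘ.*-cong (ℚᵘ.≃-sym (toℚᵘ-fromℚᵘ p)) (ℚᵘ.≃-sym (toℚᵘ-fromℚᵘ q))) ⟩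
  fromℚᵘ (toℚᵘ (fromℚᵘ p) ℚᵘ.* toℚᵘ (fromℚᵘ q))
    ≡⟨ fromℚᵘ-cong (ℚᵘ.≃-sym (toℚᵘ-homo-* (fromℚᵘ p) (fromℚᵘ q))) ⟩
  fromℚᵘ (toℚᵘ (fromℚᵘ p * fromℚᵘ q))           ≡⟨ fromℚᵘ-toℚᵘ _ ⟩
  fromℚᵘ p * fromℚᵘ q                           ∎

evalᵘ : RatFun → ℕ → ℚᵘ.ℚᵘ
evalᵘ (p /1+ q) k = ℚᵘ.mkℚᵘ (+ (p at k)) (q at k)
evalᵘ (e ⊕ f)   k = evalᵘ e k ℚᵘ.+ evalᵘ f k
evalᵘ (e ⊗ f)   k = evalᵘ e k ℚᵘ.* evalᵘ f k

normalForm : RatFun → ℕ → ℚᵘ.ℚᵘ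
normalForm e k = ℚᵘ.mkℚᵘ (+ (num e at k)) (den e at k)

eval≡fromℚᵘ-evalᵘ : ∀ e k → eval e k ≡ fromℚᵘ (evalᵘ e k)
eval≡fromℚᵘ-evalᵘ (p /1+ q) k = refl
eval≡fromℚᵘ-evalᵘ (e ⊕ f) k =
  trans (cong₂ _+_ (eval≡fromℚᵘ-evalᵘ e k) (eval≡fromℚᵘ-evalᵘ f k)) (sym (fromℚᵘ-homo-+ (evalᵘ e k) (evalᵘ f k)))
eval≡fromℚᵘ-evalᵘ (e ⊗ f) k =
  trans (cong₂ _*_ (eval≡fromℚᵘ-evalᵘ e k) (eval≡fromℚᵘ-evalᵘ f k)) (sym (fromℚᵘ-homo-* (evalᵘ e k) (evalᵘ f k)))

evalᵘ≃normalForm : ∀ e k → evalᵘ e k ℚᵘ.≃ normalForm e k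
evalᵘ≃normalForm (p /1+ q) k = ℚᵘ.≃-refl
evalᵘ≃normalForm (e ⊕ f) k =
  ℚᵘ.≃-trans (ℚᵘ.+-cong (evalᵘ≃normalForm e k) (evalᵘ≃normalForm f k))
    (ℚᵘ.≃-reflexive (cong (λ a → ℚᵘ.mkℚᵘ a (den (e ⊕ f) at k)) (begin
      + a ℤ.* + suc d′ ℤ.+ + a′ ℤ.* + suc d ≡⟨ cong₂ ℤ._+_ (sym (ℤ.pos-* a (suc d′))) (sym (ℤ.pos-* a′ (suc d))) ⟩
      + (a ℕ.* suc d′) ℤ.+ + (a′ ℕ.* suc d) ≡⟨ sym (ℤ.pos-+ (a ℕ.* suc d′) (a′ ℕ.* suc d)) ⟩
      + (a ℕ.* suc d′ ℕ.+ a′ ℕ.* suc d)     ∎)))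
  where
  a d a′ d′ : ℕ
  a = num e at k; d = den e at k; a′ = num f at k; d′ = den f at k
evalᵘ≃normalForm (e ⊗ f) k =
  ℚᵘ.≃-trans (ℚᵘ.*-cong (evalᵘ≃normalForm e k) (evalᵘ≃normalForm f k))
    (ℚᵘ.≃-reflexive (cong (λ a → ℚᵘ.mkℚᵘ a (den (e ⊗ f) at k)) (sym (ℤ.pos-* (num e at k) (num f at k)))))

eval-cross : ∀ e f k →
  (num e ⊠ (# 1 ⊞ den f)) at k ≡ (num f ⊠ (# 1 ⊞ den e)) at k →
  eval e k ≡ eval f k
eval-cross e f k cross = begin
  eval e k            ≡⟨ eval≡fromℚᵘ-evalᵘ e k ⟩
  fromℚᵘ (evalᵘ e k) ≡⟨ fromℚᵘ-cong (ℚᵘ.≃-trans (evalᵘ≃normalForm e k)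
                          (ℚᵘ.≃-trans normalForms-≃ (ℚᵘ.≃-sym (evalᵘ≃normalForm f k)))) ⟩
  fromℚᵘ (evalᵘ f k) ≡⟨ eval≡fromℚᵘ-evalᵘ f k ⟨
  eval f k            ∎
  where
  normalForms-≃ : normalForm e k ℚᵘ.≃ normalForm f k
  normalForms-≃ = ℚᵘ.*≡* (begin
    + (num e at k) ℤ.* + suc (den f at k)   ≡⟨ ℤ.pos-* (num e at k) (suc (den f at k)) ⟨
    + (num e at k ℕ.* suc (den f at k))     ≡⟨ cong +_ cross ⟩
    + (num f at k ℕ.* suc (den e at k))     ≡⟨ ℤ.pos-* (num f at k) (suc (den e at k)) ⟩
    + (num f at k) ℤ.* + suc (den e at k)   ∎)

infix 4 _≐_
record _≐_ (e f : RatFun) : Set where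
  field pointwise : ∀ k → eval e k ≡ eval f k
open _≐_

≐-by-normalisation : ∀ {e f} →
  ℕ-Poly.normalise (num e ⊠ (# 1 ⊞ den f)) ≡ ℕ-Poly.normalise (num f ⊠ (# 1 ⊞ den e)) →
  e ≐ f
≐-by-normalisation {e} {f} same .pointwise k =
  eval-cross e f k (ℕ-Poly.prove (k ∷ []) lhs rhs (cong (λ p → ℕ-Poly.⟦ p ⟧N (k ∷ [])) same))
  where
  lhs rhs : Poly
  lhs = num e ⊠ (# 1 ⊞ den f)
  rhs = num f ⊠ (# 1 ⊞ den e)

toℚ : ℕ → ℚ
toℚ n = + n / 1

toℚ-suc : ∀ n → toℚ (suc n) ≡ 1ℚ + toℚ n
toℚ-suc = successor .pointwise
  where
  successor : ` (# 1 ⊞ X) ≐ ` # 1 ⊕ ` X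
  successor = ≐-by-normalisation refl

PositiveNumerators : RatFun → ℕ → Set
PositiveNumerators (p /1+ q) k = ℕ.NonZero (p at k)
PositiveNumerators (e ⊕ f)   k = PositiveNumerators e k × PositiveNumerators f k
PositiveNumerators (e ⊗ f)   k = PositiveNumerators e k × PositiveNumerators f k

eval-pos : ∀ e k → PositiveNumerators e k → Positive (eval e k)
eval-pos (p /1+ q) k nonZero = normalize-pos (p at k) (suc (q at k)) {{_}} {{nonZero}}
eval-pos (e ⊕ f)   k (pe , pf) = ℚ.pos+pos⇒pos (eval e k) {{eval-pos e k pe}} (eval f k) {{eval-pos f k pf}}
eval-pos (e ⊗ f)   k (pe , pf) = pos*pos⇒pos (eval e k) {{eval-pos e k pe}} (eval f k) {{eval-pos f k pf}}

Σℚ-++ : ∀ xs ys → Σℚ (xs ++ ys) ≡ Σℚ xs + Σℚ ys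
Σℚ-++ []       ys = sym (ℚ.+-identityˡ (Σℚ ys))
Σℚ-++ (x ∷ xs) ys = trans (cong (_+_ x) (Σℚ-++ xs ys)) (sym (ℚ.+-assoc x (Σℚ xs) (Σℚ ys)))

Σℚ-map-++ : ∀ (F : A → ℚ) xs ys → Σℚ (map F (xs ++ ys)) ≡ Σℚ (map F xs) + Σℚ (map F ys)
Σℚ-map-++ F xs ys = trans (cong Σℚ (map-++ F xs ys)) (Σℚ-++ (map F xs) (map F ys))

Σℚ-map-*ˡ : ∀ c (F : A → ℚ) xs → Σℚ (map (λ x → c * F x) xs) ≡ c * Σℚ (map F xs)
Σℚ-map-*ˡ c F []       = sym (ℚ.*-zeroʳ c)
Σℚ-map-*ˡ c F (x ∷ xs) =
  trans (cong (_+_ (c * F x)) (Σℚ-map-*ˡ c F xs)) (sym (ℚ.*-distribˡ-+ c (F x) (Σℚ (map F xs))))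

Σℚ-map-concatMap : ∀ (F : B → ℚ) (g : A → List B) xs →
  Σℚ (map F (concatMap g xs)) ≡ Σℚ (map (λ x → Σℚ (map F (g x))) xs)
Σℚ-map-concatMap F g []       = refl
Σℚ-map-concatMap F g (x ∷ xs) =
  trans (Σℚ-map-++ F (g x) (concatMap g xs)) (cong (_+_ (Σℚ (map F (g x)))) (Σℚ-map-concatMap F g xs))

Σℚ-allFin : ∀ {n} (f : Fin n → ℚ) → Σℚ (map f (allFin n)) ≡ sum f
Σℚ-allFin f = trans (cong Σℚ (map-tabulate id f)) (Σℚ-tabulate f)
  where
  Σℚ-tabulate : ∀ {n} (f : Fin n → ℚ) → Σℚ (tabulate f) ≡ sum f
  Σℚ-tabulate {zero}  f = refl
  Σℚ-tabulate {suc n} f = cong (_+_ (f zero)) (Σℚ-tabulate (f ∘ suc))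

Σℚ-lookup : ∀ (F : A → ℚ) (L : List A) → Σℚ (map (F ∘ lookup L) (allFin (length L))) ≡ Σℚ (map F L)
Σℚ-lookup F L = trans (Σℚ-allFin (F ∘ lookup L)) (sum-lookup L)
  where
  sum-lookup : ∀ L → sum (F ∘ lookup L) ≡ Σℚ (map F L)
  sum-lookup []      = refl
  sum-lookup (x ∷ L) = cong (_+_ (F x)) (sum-lookup L)

sum-const : ∀ n c → ∑[ i < n ] c ≡ toℚ n * c
sum-const zero    c = sym (ℚ.*-zeroˡ c)
sum-const (suc n) c = begin
  c + ∑[ i < n ] c        ≡⟨ cong (_+_ c) (sum-const n c) ⟩
  c + toℚ n * c           ≡⟨ cong (_+ toℚ n * c) (ℚ.*-identityˡ c) ⟨
  1ℚ * c + toℚ n * c      ≡⟨ ℚ.*-distribʳ-+ c 1ℚ (toℚ n) ⟨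
  (1ℚ + toℚ n) * c        ≡⟨ cong (_* c) (toℚ-suc n) ⟨
  toℚ (suc n) * c         ∎

≡ᵇ-refl : ∀ n → (n ≡ᵇ n) ≡ true
≡ᵇ-refl zero    = refl
≡ᵇ-refl (suc n) = ≡ᵇ-refl n

≡ᵇ-comm : ∀ m n → (m ≡ᵇ n) ≡ (n ≡ᵇ m)
≡ᵇ-comm zero    zero    = refl
≡ᵇ-comm zero    (suc n) = refl
≡ᵇ-comm (suc m) zero    = refl
≡ᵇ-comm (suc m) (suc n) = ≡ᵇ-comm m n

sum-delta : ∀ {n} (i : Fin n) (g : Fin n → ℚ) → ∑[ j < n ] (if toℕ j ≡ᵇ toℕ i then g j else 0ℚ) ≡ g i
sum-delta {suc n} zero    g = trans (cong (_+_ (g zero)) (sum-zero n)) (ℚ.+-identityʳ (g zero))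
  where
  sum-zero : ∀ n → ∑[ j < n ] 0ℚ ≡ 0ℚ
  sum-zero zero    = refl
  sum-zero (suc n) = cong (_+_ 0ℚ) (sum-zero n)
sum-delta {suc n} (suc i) g = trans (ℚ.+-identityˡ (∑[ j < n ] (if toℕ j ≡ᵇ toℕ i then g (suc j) else 0ℚ))) (sum-delta i (g ∘ suc))

Σℚ-indices : ∀ m (G : ℕ → ℚ) → Σℚ (map G (indices m)) ≡ ∑[ j < m ] G (toℕ j)
Σℚ-indices zero    G = refl
Σℚ-indices (suc m) G = begin
  Σℚ (map G (indices m ++ m ∷ []))                      ≡⟨ Σℚ-map-++ G (indices m) (m ∷ []) ⟩
  Σℚ (map G (indices m)) + (G m + 0ℚ)                   ≡⟨ cong₂ _+_ (Σℚ-indices m G) (ℚ.+-identityʳ (G m)) ⟩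
  ∑[ j < m ] G (toℕ j) + G m                            ≡⟨ cong₂ _+_ (sum-cong-≗ {m} (λ j → cong G (sym (toℕ-inject₁ j))))
                                                                    (cong G (sym (toℕ-fromℕ m))) ⟩
  ∑[ j < m ] G (toℕ (inject₁ j)) + G (toℕ (fromℕ m))   ≡⟨ sum-init-last {m} (λ j → G (toℕ j)) ⟨
  ∑[ j < suc m ] G (toℕ j)                              ∎

-- Coordinates of the vertices

module _ (m : ℕ) where

  point-last : ∀ (f : ℕ → ℚ) a → point (suc m) f a (fromℕ m) ≡ a
  point-last f a rewrite toℕ-fromℕ m | ≡ᵇ-refl m = refl

  point-init : ∀ (f : ℕ → ℚ) a (i : Fin m) → point (suc m) f a (inject₁ i) ≡ f (toℕ i)
  point-init f a i rewrite toℕ-inject₁ i = cong (if_then a else f (toℕ i)) (below i)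
    where
    below : ∀ {m} (i : Fin m) → (toℕ i ≡ᵇ m) ≡ false
    below {suc m} zero    = refl
    below {suc m} (suc i) = below i

matQF-diagonal : ∀ {n} (d : Fin n → ℚ) (x : Vec n) →
  matQF (λ i j → if toℕ i ≡ᵇ toℕ j then d i else 0ℚ) x ≡ ∑[ i < n ] (x i * d i * x i)
matQF-diagonal {n} d x = begin
  Σℚ (map (λ i → Σℚ (map (λ j → x i * D i j * x j) (allFin n))) (allFin n))
    ≡⟨ cong Σℚ (map-cong (λ i → Σℚ-allFin (λ j → x i * D i j * x j)) (allFin n)) ⟩
  Σℚ (map (λ i → ∑[ j < n ] (x i * D i j * x j)) (allFin n))
    ≡⟨ Σℚ-allFin (λ i → ∑[ j < n ] (x i * D i j * x j)) ⟩
  ∑[ i < n ] ∑[ j < n ] (x i * D i j * x j)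
    ≡⟨ sum-cong-≗ (λ i → trans (sum-cong-≗ (entry i)) (sum-delta i (λ j → x i * d i * x j))) ⟩
  ∑[ i < n ] (x i * d i * x i) ∎
  where
  D : Fin n → Fin n → ℚ
  D i j = if toℕ i ≡ᵇ toℕ j then d i else 0ℚ
  entry : ∀ i j → x i * D i j * x j ≡ (if toℕ j ≡ᵇ toℕ i then x i * d i * x j else 0ℚ)
  entry i j rewrite ≡ᵇ-comm (toℕ i) (toℕ j) with toℕ j ≡ᵇ toℕ i
  ... | true  = refl
  ... | false = trans (cong (_* x j) (ℚ.*-zeroʳ (x i))) (ℚ.*-zeroˡ (x j))

module Coordinates {m : ℕ} (y : Vec (suc m)) where

  z : Fin m → ℚ
  z i = y (inject₁ i)

  t S Q : ℚ
  t = y (fromℕ m)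
  S = sum z
  Q = ∑[ i < m ] (z i * z i)

  coord : ℕ → ℚ
  coord i = ∑[ j < m ] (if toℕ j ≡ᵇ i then z j else 0ℚ)

  coord-toℕ : ∀ j → coord (toℕ j) ≡ z j
  coord-toℕ j = sum-delta j z

  dot-point : ∀ (f : ℕ → ℚ) a → dot (point (suc m) f a) y ≡ ∑[ i < m ] (f (toℕ i) * z i) + a * t
  dot-point f a = begin
    Σℚ (map (λ i → point (suc m) f a i * y i) (allFin (suc m)))  ≡⟨ Σℚ-allFin (λ i → point (suc m) f a i * y i) ⟩
    ∑[ i < suc m ] (point (suc m) f a i * y i)                    ≡⟨ sum-init-last (λ i → point (suc m) f a i * y i) ⟩
    ∑[ i < m ] (point (suc m) f a (inject₁ i) * z i) + point (suc m) f a (fromℕ m) * t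
      ≡⟨ cong₂ _+_ (sum-cong-≗ (λ i → cong (_* z i) (point-init m f a i))) (cong (_* t) (point-last m f a)) ⟩
    ∑[ i < m ] (f (toℕ i) * z i) + a * t                           ∎

  dot-halfPt : ∀ a → dot (halfPt (suc m) a) y ≡ half * S + a * t
  dot-halfPt a = trans (dot-point (λ _ → half) a) (cong (_+ a * t) (sym (*-distribˡ-sum half z)))

  dot-halfPtShift : ∀ σ i s → dot (halfPtShift (suc m) σ i s) y ≡ (half * S + s * coord i) + σ * t
  dot-halfPtShift σ i s = trans (dot-point (λ j → if j ≡ᵇ i then half + s else half) σ) (cong (_+ σ * t) (begin
    ∑[ j < m ] ((if toℕ j ≡ᵇ i then half + s else half) * z j)    ≡⟨ sum-cong-≗ (λ j → shift (toℕ j ≡ᵇ i) (z j)) ⟩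
    ∑[ j < m ] (half * z j + s * δ j)                             ≡⟨ ∑-distrib-+ (λ j → half * z j) (λ j → s * δ j) ⟩
    ∑[ j < m ] (half * z j) + ∑[ j < m ] (s * δ j)                ≡⟨ cong₂ _+_ (sym (*-distribˡ-sum half z)) (sym (*-distribˡ-sum s δ)) ⟩
    half * S + s * coord i                                         ∎))
    where
    δ : Fin m → ℚ
    δ j = if toℕ j ≡ᵇ i then z j else 0ℚ
    shift : ∀ b x → (if b then half + s else half) * x ≡ half * x + s * (if b then x else 0ℚ)
    shift true  x = ℚ.*-distribʳ-+ x half s
    shift false x = sym (trans (cong (_+_ (half * x)) (ℚ.*-zeroʳ s)) (ℚ.+-identityʳ (half * x)))

  matQF-QinvMat : matQF (QinvMat (suc m)) y ≡ Q + t * qInvLast (suc m) * t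
  matQF-QinvMat = begin
    matQF (QinvMat (suc m)) y                       ≡⟨ matQF-diagonal d y ⟩
    ∑[ i < suc m ] (y i * d i * y i)                ≡⟨ sum-init-last (λ i → y i * d i * y i) ⟩
    ∑[ i < m ] (z i * d (inject₁ i) * z i) + t * d (fromℕ m) * t
      ≡⟨ cong₂ _+_ (sum-cong-≗ λ i → cong (λ c → z i * c * z i) (point-init m (λ _ → 1ℚ) (qInvLast (suc m)) i))
                   (cong (λ c → t * c * t) (point-last m (λ _ → 1ℚ) (qInvLast (suc m)))) ⟩
    ∑[ i < m ] (z i * 1ℚ * z i) + t * qInvLast (suc m) * t
      ≡⟨ cong (_+ t * qInvLast (suc m) * t) (sum-cong-≗ λ i → cong (_* z i) (ℚ.*-identityʳ (z i))) ⟩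
    Q + t * qInvLast (suc m) * t                    ∎
    where
    -- The diagonal of QinvMat has the shape of a point, so point-init and point-last evaluate it.
    d : Fin (suc m) → ℚ
    d = point (suc m) (λ _ → 1ℚ) (qInvLast (suc m))

-- Sums of squares over the half cube

filterB-++ : ∀ (P : A → Bool) xs ys → filterB P (xs ++ ys) ≡ filterB P xs ++ filterB P ys
filterB-++ P []       ys = refl
filterB-++ P (x ∷ xs) ys with P x
... | true  = cong (x ∷_) (filterB-++ P xs ys)
... | false = filterB-++ P xs ys

filterB-map : ∀ (P : B → Bool) (g : A → B) xs → filterB P (map g xs) ≡ map g (filterB (P ∘ g) xs)
filterB-map P g []       = refl
filterB-map P g (x ∷ xs) with P (g x)
... | true  = cong (g x ∷_) (filterB-map P g xs)
... | false = filterB-map P g xs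

filterB-cong : ∀ {P P′ : A → Bool} → (∀ x → P x ≡ P′ x) → ∀ xs → filterB P xs ≡ filterB P′ xs
filterB-cong eq []       = refl
filterB-cong {P′ = P′} eq (x ∷ xs) rewrite eq x with P′ x
... | true  = cong (x ∷_) (filterB-cong eq xs)
... | false = filterB-cong eq xs

infix 7 _·_
_·_ : ∀ {m} → List Bool → (Fin m → ℚ) → ℚ
_·_ {m} h z = ∑[ i < m ] (bitAt h (toℕ i) * z i)

sq : ℚ → ℚ
sq u = u * u

squareSum : (List Bool → Bool) → ∀ m → ℚ → (Fin m → ℚ) → ℚ
squareSum P m c z = Σℚ (map (λ h → sq (c + h · z)) (filterB P (bits m)))

squareSum-suc : ∀ P m c (z : Fin (suc m) → ℚ) →
  squareSum P (suc m) c z ≡ squareSum (P ∘ (false ∷_)) m c (z ∘ suc) + squareSum (P ∘ (true ∷_)) m (c + z zero) (z ∘ suc)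
squareSum-suc P m c z = begin
  Σℚ (map F (filterB P (map (false ∷_) (bits m) ++ map (true ∷_) (bits m))))
    ≡⟨ cong (Σℚ ∘ map F) (filterB-++ P (map (false ∷_) (bits m)) (map (true ∷_) (bits m))) ⟩
  Σℚ (map F (filterB P (map (false ∷_) (bits m)) ++ filterB P (map (true ∷_) (bits m))))
    ≡⟨ Σℚ-map-++ F (filterB P (map (false ∷_) (bits m))) (filterB P (map (true ∷_) (bits m))) ⟩
  Σℚ (map F (filterB P (map (false ∷_) (bits m)))) + Σℚ (map F (filterB P (map (true ∷_) (bits m))))
    ≡⟨ cong₂ _+_ (prepend false dropZero) (prepend true absorbOne) ⟩
  squareSum (P ∘ (false ∷_)) m c (z ∘ suc) + squareSum (P ∘ (true ∷_)) m (c + z zero) (z ∘ suc) ∎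
  where
  F : List Bool → ℚ
  F h = sq (c + h · z)
  z′ : Fin m → ℚ
  z′ = z ∘ suc
  dropZero : ∀ h → F (false ∷ h) ≡ sq (c + h · z′)
  dropZero h = cong (λ u → sq (c + u)) (trans (cong (_+ h · z′) (ℚ.*-zeroˡ (z zero))) (ℚ.+-identityˡ (h · z′)))
  absorbOne : ∀ h → F (true ∷ h) ≡ sq ((c + z zero) + h · z′)
  absorbOne h = cong sq (trans (cong (λ u → c + (u + h · z′)) (ℚ.*-identityˡ (z zero))) (sym (ℚ.+-assoc c (z zero) (h · z′))))
  prepend : ∀ b {G : List Bool → ℚ} → (∀ h → F (b ∷ h) ≡ G h) →
    Σℚ (map F (filterB P (map (b ∷_) (bits m)))) ≡ Σℚ (map G (filterB (P ∘ (b ∷_)) (bits m)))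
  prepend b {G} eq = begin
    Σℚ (map F (filterB P (map (b ∷_) (bits m))))               ≡⟨ cong (Σℚ ∘ map F) (filterB-map P (b ∷_) (bits m)) ⟩
    Σℚ (map F (map (b ∷_) (filterB (P ∘ (b ∷_)) (bits m))))    ≡⟨ cong Σℚ (map-∘ (filterB (P ∘ (b ∷_)) (bits m))) ⟨
    Σℚ (map (F ∘ (b ∷_)) (filterB (P ∘ (b ∷_)) (bits m)))      ≡⟨ cong Σℚ (map-cong eq (filterB (P ∘ (b ∷_)) (bits m))) ⟩
    Σℚ (map G (filterB (P ∘ (b ∷_)) (bits m)))                  ∎

four : ℚ
four = + 4 / 1

cubeMoment : ℚ → ℚ → ℚ → ℚ
cubeMoment c S Q = four * (c * c) + four * (c * S) + (S * S + Q)

cubeMoment-step : ∀ c a S Q → half * (cubeMoment c S Q + cubeMoment (c + a) S Q) ≡ cubeMoment c (a + S) (a * a + Q)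
cubeMoment-step = solve 4 (λ c a S Q → con half :* (M c S Q :+ M (c :+ a) S Q) := M c (a :+ S) (a :* a :+ Q)) refl
  where
  open ℚ-Solver.+-*-Solver
  M : Polynomial 4 → Polynomial 4 → Polynomial 4 → Polynomial 4
  M c S Q = con four :* (c :* c) :+ con four :* (c :* S) :+ (S :* S :+ Q)

halfCube-squareSum : ∀ j c (z : Fin (3 ℕ.+ j) → ℚ) →
  half ^ j * squareSum evenBits (3 ℕ.+ j) c z ≡ cubeMoment c (sum z) (∑[ i < 3 ℕ.+ j ] (z i * z i)) ×
  half ^ j * squareSum (not ∘ evenBits) (3 ℕ.+ j) c z ≡ cubeMoment c (sum z) (∑[ i < 3 ℕ.+ j ] (z i * z i))
halfCube-squareSum zero c z =
  solve 4 (λ c a b d → con 1ℚ :* squares c a b d evenVertices := moment c a b d) refl c (z zero) (z (suc zero)) (z (suc (suc zero))) ,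
  solve 4 (λ c a b d → con 1ℚ :* squares c a b d oddVertices := moment c a b d) refl c (z zero) (z (suc zero)) (z (suc (suc zero)))
  where
  open ℚ-Solver.+-*-Solver
  squares : Polynomial 4 → Polynomial 4 → Polynomial 4 → Polynomial 4 → List (ℚ × ℚ × ℚ) → Polynomial 4
  squares c a b d []                  = con 0ℚ
  squares c a b d ((α , β , γ) ∷ hs) = h :* h :+ squares c a b d hs
    where
    h : Polynomial 4
    h = c :+ (con α :* a :+ (con β :* b :+ (con γ :* d :+ con 0ℚ)))
  moment : Polynomial 4 → Polynomial 4 → Polynomial 4 → Polynomial 4 → Polynomial 4
  moment c a b d = con four :* (c :* c) :+ con four :* (c :* S) :+ (S :* S :+ (a :* a :+ (b :* b :+ (d :* d :+ con 0ℚ))))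
    where
    S : Polynomial 4
    S = a :+ (b :+ (d :+ con 0ℚ))
  -- Listed in the order in which filterB enumerates bits 3, so that solve's left side is the goal up to conversion.
  evenVertices oddVertices : List (ℚ × ℚ × ℚ)
  evenVertices = (0ℚ , 0ℚ , 0ℚ) ∷ (0ℚ , 1ℚ , 1ℚ) ∷ (1ℚ , 0ℚ , 1ℚ) ∷ (1ℚ , 1ℚ , 0ℚ) ∷ []
  oddVertices  = (0ℚ , 0ℚ , 1ℚ) ∷ (0ℚ , 1ℚ , 0ℚ) ∷ (1ℚ , 0ℚ , 0ℚ) ∷ (1ℚ , 1ℚ , 1ℚ) ∷ []
halfCube-squareSum (suc j) c z =
  step evenBits (proj₁ (halfCube-squareSum j c z′)) (proj₂ (halfCube-squareSum j (c + z zero) z′)) ,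
  step (not ∘ evenBits) (proj₂ (halfCube-squareSum j c z′))
       (trans (cong (λ hs → half ^ j * Σℚ (map (λ h → sq ((c + z zero) + h · z′)) hs))
                    (filterB-cong (not-involutive ∘ evenBits) (bits (3 ℕ.+ j))))
              (proj₁ (halfCube-squareSum j (c + z zero) z′)))
  where
  z′ : Fin (3 ℕ.+ j) → ℚ
  z′ = z ∘ suc
  S′ Q′ : ℚ
  S′ = sum z′
  Q′ = ∑[ i < 3 ℕ.+ j ] (z′ i * z′ i)
  step : ∀ P → half ^ j * squareSum (P ∘ (false ∷_)) (3 ℕ.+ j) c z′ ≡ cubeMoment c S′ Q′ →
               half ^ j * squareSum (P ∘ (true ∷_)) (3 ℕ.+ j) (c + z zero) z′ ≡ cubeMoment (c + z zero) S′ Q′ →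
         half ^ suc j * squareSum P (4 ℕ.+ j) c z ≡ cubeMoment c (z zero + S′) (z zero * z zero + Q′)
  step P hA hB = begin
    (half * half ^ j) * squareSum P (4 ℕ.+ j) c z  ≡⟨ cong (half * half ^ j *_) (squareSum-suc P (3 ℕ.+ j) c z) ⟩
    (half * half ^ j) * (Σ₀ + Σ₁)            ≡⟨ ℚ.*-assoc half (half ^ j) (Σ₀ + Σ₁) ⟩
    half * (half ^ j * (Σ₀ + Σ₁))            ≡⟨ cong (half *_) (ℚ.*-distribˡ-+ (half ^ j) Σ₀ Σ₁) ⟩
    half * (half ^ j * Σ₀ + half ^ j * Σ₁)   ≡⟨ cong (half *_) (cong₂ _+_ hA hB) ⟩
    half * (cubeMoment c S′ Q′ + cubeMoment (c + z zero) S′ Q′) ≡⟨ cubeMoment-step c (z zero) S′ Q′ ⟩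
    cubeMoment c (z zero + S′) (z zero * z zero + Q′) ∎
    where
    Σ₀ Σ₁ : ℚ
    Σ₀ = squareSum (P ∘ (false ∷_)) (3 ℕ.+ j) c z′
    Σ₁ = squareSum (P ∘ (true ∷_)) (3 ℕ.+ j) (c + z zero) z′

half^-pos : ∀ j → Positive (half ^ j)
half^-pos zero    = _
half^-pos (suc j) = pos*pos⇒pos half (half ^ j) {{half^-pos j}}

halfCube-weighted : ∀ j c₀ (z : Fin (3 ℕ.+ j) → ℚ) →
  (c₀ * half ^ j) * squareSum evenBits (3 ℕ.+ j) 1ℚ z ≡ c₀ * cubeMoment 1ℚ (sum z) (∑[ i < 3 ℕ.+ j ] (z i * z i))
halfCube-weighted j c₀ z =
  trans (ℚ.*-assoc c₀ (half ^ j) (squareSum evenBits (3 ℕ.+ j) 1ℚ z)) (cong (c₀ *_) (proj₁ (halfCube-squareSum j 1ℚ z)))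

-- Weighted vertex sums

two : ℚ
two = + 2 / 1

layerWeight : ℚ → ℚ → ℚ → ℚ → ℚ
layerWeight w₊ w₋ w₀ x = if does (x ≟ 1ℚ) then w₊ else if does (x ≟ - 1ℚ) then w₋ else w₀

layerWeight-pos : ∀ {w₊ w₋ w₀} → Positive w₊ → Positive w₋ → Positive w₀ → ∀ x → Positive (layerWeight w₊ w₋ w₀ x)
layerWeight-pos p₊ p₋ p₀ x with does (x ≟ 1ℚ)
... | true  = p₊
... | false with does (x ≟ - 1ℚ)
...   | true  = p₋
...   | false = p₀

shiftPair-sum : ∀ w A Z T →
  w * sq (1ℚ + ((A + 1ℚ * Z) + T)) + (w * sq (1ℚ + ((A + - 1ℚ * Z) + T)) + 0ℚ)
  ≡ two * w * sq (1ℚ + (A + T)) + two * w * (Z * Z)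
shiftPair-sum = solve 4 (λ w A Z T →
  w :* sqₚ (con 1ℚ :+ ((A :+ con 1ℚ :* Z) :+ T)) :+ (w :* sqₚ (con 1ℚ :+ ((A :+ con (- 1ℚ) :* Z) :+ T)) :+ con 0ℚ)
  := con two :* w :* sqₚ (con 1ℚ :+ (A :+ T)) :+ con two :* w :* (Z :* Z)) refl
  where
  open ℚ-Solver.+-*-Solver
  sqₚ : Polynomial 4 → Polynomial 4
  sqₚ u = u :* u

shiftQuadruple-sum : ∀ w₊ w₋ A Z t →
  w₊ * sq (1ℚ + ((A + 1ℚ * Z) + 1ℚ * t)) + (w₊ * sq (1ℚ + ((A + - 1ℚ * Z) + 1ℚ * t))
  + (w₋ * sq (1ℚ + ((A + 1ℚ * Z) + - 1ℚ * t)) + (w₋ * sq (1ℚ + ((A + - 1ℚ * Z) + - 1ℚ * t)) + 0ℚ)))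
  ≡ (two * w₊ * sq (1ℚ + (A + 1ℚ * t)) + two * w₋ * sq (1ℚ + (A + - 1ℚ * t))) + two * (w₊ + w₋) * (Z * Z)
shiftQuadruple-sum = solve 5 (λ w₊ w₋ A Z t →
  w₊ :* sqₚ (con 1ℚ :+ ((A :+ con 1ℚ :* Z) :+ con 1ℚ :* t)) :+ (w₊ :* sqₚ (con 1ℚ :+ ((A :+ con (- 1ℚ) :* Z) :+ con 1ℚ :* t))
  :+ (w₋ :* sqₚ (con 1ℚ :+ ((A :+ con 1ℚ :* Z) :+ con (- 1ℚ) :* t)) :+ (w₋ :* sqₚ (con 1ℚ :+ ((A :+ con (- 1ℚ) :* Z) :+ con (- 1ℚ) :* t)) :+ con 0ℚ)))
  := (con two :* w₊ :* sqₚ (con 1ℚ :+ (A :+ con 1ℚ :* t)) :+ con two :* w₋ :* sqₚ (con 1ℚ :+ (A :+ con (- 1ℚ) :* t)))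
     :+ con two :* (w₊ :+ w₋) :* (Z :* Z)) refl
  where
  open ℚ-Solver.+-*-Solver
  sqₚ : Polynomial 5 → Polynomial 5
  sqₚ u = u :* u

module VertexSums {m : ℕ} (y : Vec (suc m)) (w₊ w₋ w₀ : ℚ) where
  open Coordinates y

  weighted : Vec (suc m) → ℚ
  weighted v = layerWeight w₊ w₋ w₀ (v (fromℕ m)) * ev v y

  weighted-shift : ∀ σ i s →
    weighted (halfPtShift (suc m) σ i s) ≡ layerWeight w₊ w₋ w₀ σ * sq (1ℚ + ((half * S + s * coord i) + σ * t))
  weighted-shift σ i s =
    cong₂ (λ u d → layerWeight w₊ w₋ w₀ u * sq (1ℚ + d))
          (point-last m (λ j → if j ≡ᵇ i then half + s else half) σ) (dot-halfPtShift σ i s)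

  cubeLayer : Σℚ (map weighted (cubePts (suc m))) ≡ w₀ * squareSum evenBits m 1ℚ z
  cubeLayer = begin
    Σℚ (map weighted (map cubePoint (halfCube m)))    ≡⟨ cong Σℚ (map-∘ (halfCube m)) ⟨
    Σℚ (map (weighted ∘ cubePoint) (halfCube m))      ≡⟨ cong Σℚ (map-cong onCubePoint (halfCube m)) ⟩
    Σℚ (map (λ h → w₀ * sq (1ℚ + h · z)) (halfCube m)) ≡⟨ Σℚ-map-*ˡ w₀ (λ h → sq (1ℚ + h · z)) (halfCube m) ⟩
    w₀ * squareSum evenBits m 1ℚ z                     ∎
    where
    cubePoint : List Bool → Vec (suc m)
    cubePoint h = point (suc m) (bitAt h) 0ℚ
    onCubePoint : ∀ h → weighted (cubePoint h) ≡ w₀ * sq (1ℚ + h · z)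
    onCubePoint h = cong₂ (λ u d → layerWeight w₊ w₋ w₀ u * sq (1ℚ + d)) (point-last m (bitAt h) 0ℚ)
      (trans (dot-point (bitAt h) 0ℚ) (trans (cong (_+_ (h · z)) (ℚ.*-zeroˡ t)) (ℚ.+-identityʳ (h · z))))

  indexLayer : ∀ (g : ℕ → List (Vec (suc m))) C D → (∀ i → Σℚ (map weighted (g i)) ≡ C + D * (coord i * coord i)) →
    Σℚ (map weighted (concatMap g (indices m))) ≡ toℚ m * C + D * Q
  indexLayer g C D layer = begin
    Σℚ (map weighted (concatMap g (indices m)))                 ≡⟨ Σℚ-map-concatMap weighted g (indices m) ⟩
    Σℚ (map (λ i → Σℚ (map weighted (g i))) (indices m))        ≡⟨ cong Σℚ (map-cong layer (indices m)) ⟩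
    Σℚ (map (λ i → C + D * (coord i * coord i)) (indices m))    ≡⟨ Σℚ-indices m (λ i → C + D * (coord i * coord i)) ⟩
    ∑[ j < m ] (C + D * (coord (toℕ j) * coord (toℕ j)))        ≡⟨ sum-cong-≗ (λ j → cong (λ u → C + D * (u * u)) (coord-toℕ j)) ⟩
    ∑[ j < m ] (C + D * (z j * z j))                            ≡⟨ ∑-distrib-+ (λ _ → C) (λ j → D * (z j * z j)) ⟩
    ∑[ j < m ] C + ∑[ j < m ] (D * (z j * z j))                 ≡⟨ cong₂ _+_ (sum-const m C) (sym (*-distribˡ-sum D (λ j → z j * z j))) ⟩
    toℚ m * C + D * Q                                           ∎

  evenVertices-sum : Σℚ (map weighted (vertsEven (suc m))) ≡
    (toℚ m * (two * w₊ * sq (1ℚ + (half * S + 1ℚ * t))) + two * w₊ * Q)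
    + ((w₋ * sq (1ℚ + (half * S + - 1ℚ * t)) + 0ℚ) + w₀ * squareSum evenBits m 1ℚ z)
  evenVertices-sum = begin
    Σℚ (map weighted (concatMap pair (indices m) ++ bottom))
      ≡⟨ Σℚ-map-++ weighted (concatMap pair (indices m)) bottom ⟩
    Σℚ (map weighted (concatMap pair (indices m))) + Σℚ (map weighted bottom)
      ≡⟨ cong₂ _+_ (indexLayer pair (two * w₊ * sq (1ℚ + (half * S + 1ℚ * t))) (two * w₊) pairSum)
                   (Σℚ-map-++ weighted (halfPt (suc m) (- 1ℚ) ∷ []) (cubePts (suc m))) ⟩
    (toℚ m * (two * w₊ * sq (1ℚ + (half * S + 1ℚ * t))) + two * w₊ * Q)
    + ((weighted (halfPt (suc m) (- 1ℚ)) + 0ℚ) + Σℚ (map weighted (cubePts (suc m))))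
      ≡⟨ cong (_+_ (toℚ m * (two * w₊ * sq (1ℚ + (half * S + 1ℚ * t))) + two * w₊ * Q))
              (cong₂ _+_ (cong (_+ 0ℚ) bottomVertex) cubeLayer) ⟩
    (toℚ m * (two * w₊ * sq (1ℚ + (half * S + 1ℚ * t))) + two * w₊ * Q)
    + ((w₋ * sq (1ℚ + (half * S + - 1ℚ * t)) + 0ℚ) + w₀ * squareSum evenBits m 1ℚ z) ∎
    where
    bottom : List (Vec (suc m))
    bottom = halfPt (suc m) (- 1ℚ) ∷ [] ++ cubePts (suc m)
    pair : ℕ → List (Vec (suc m))
    pair i = halfPtShift (suc m) 1ℚ i 1ℚ ∷ halfPtShift (suc m) 1ℚ i (- 1ℚ) ∷ []
    pairSum : ∀ i → Σℚ (map weighted (pair i)) ≡ two * w₊ * sq (1ℚ + (half * S + 1ℚ * t)) + two * w₊ * (coord i * coord i)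
    pairSum i = trans (cong₂ (λ u v → u + (v + 0ℚ)) (weighted-shift 1ℚ i 1ℚ) (weighted-shift 1ℚ i (- 1ℚ)))
                      (shiftPair-sum w₊ (half * S) (coord i) (1ℚ * t))
    bottomVertex : weighted (halfPt (suc m) (- 1ℚ)) ≡ w₋ * sq (1ℚ + (half * S + - 1ℚ * t))
    bottomVertex = cong₂ (λ u d → layerWeight w₊ w₋ w₀ u * sq (1ℚ + d)) (point-last m (λ _ → half) (- 1ℚ)) (dot-halfPt (- 1ℚ))

  oddVertices-sum : Σℚ (map weighted (vertsOdd (suc m))) ≡
    (toℚ m * (two * w₊ * sq (1ℚ + (half * S + 1ℚ * t)) + two * w₋ * sq (1ℚ + (half * S + - 1ℚ * t)))
      + two * (w₊ + w₋) * Q)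
    + w₀ * squareSum evenBits m 1ℚ z
  oddVertices-sum = begin
    Σℚ (map weighted (concatMap quadruple (indices m) ++ cubePts (suc m)))
      ≡⟨ Σℚ-map-++ weighted (concatMap quadruple (indices m)) (cubePts (suc m)) ⟩
    Σℚ (map weighted (concatMap quadruple (indices m))) + Σℚ (map weighted (cubePts (suc m)))
      ≡⟨ cong₂ _+_ (indexLayer quadruple (two * w₊ * sq (1ℚ + (half * S + 1ℚ * t)) + two * w₋ * sq (1ℚ + (half * S + - 1ℚ * t)))
                                (two * (w₊ + w₋)) quadrupleSum) cubeLayer ⟩
    (toℚ m * (two * w₊ * sq (1ℚ + (half * S + 1ℚ * t)) + two * w₋ * sq (1ℚ + (half * S + - 1ℚ * t)))
      + two * (w₊ + w₋) * Q)
    + w₀ * squareSum evenBits m 1ℚ z ∎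
    where
    quadruple : ℕ → List (Vec (suc m))
    quadruple i = halfPtShift (suc m) 1ℚ i 1ℚ ∷ halfPtShift (suc m) 1ℚ i (- 1ℚ)
                ∷ halfPtShift (suc m) (- 1ℚ) i 1ℚ ∷ halfPtShift (suc m) (- 1ℚ) i (- 1ℚ) ∷ []
    quadrupleSum : ∀ i → Σℚ (map weighted (quadruple i)) ≡
      (two * w₊ * sq (1ℚ + (half * S + 1ℚ * t)) + two * w₋ * sq (1ℚ + (half * S + - 1ℚ * t)))
      + two * (w₊ + w₋) * (coord i * coord i)
    quadrupleSum i =
      trans (cong₂ _+_ (weighted-shift 1ℚ i 1ℚ) (cong₂ _+_ (weighted-shift 1ℚ i (- 1ℚ))
              (cong₂ _+_ (weighted-shift (- 1ℚ) i 1ℚ) (cong (_+ 0ℚ) (weighted-shift (- 1ℚ) i (- 1ℚ))))))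
            (shiftQuadruple-sum w₊ w₋ (half * S) (coord i) t)

-- Matching coefficients

inBasis : (S t Q c₁ c₂ c₃ c₄ : ℚ) → ℚ
inBasis S t Q c₁ c₂ c₃ c₄ = c₁ * sq (1ℚ + half * S) + c₂ * (t * (two + S)) + c₃ * (t * t) + c₄ * Q

inBasis-cong : ∀ S t Q {c₁ c₂ c₃ c₄ d₁ d₂ d₃ d₄} → c₁ ≡ d₁ → c₂ ≡ d₂ → c₃ ≡ d₃ → c₄ ≡ d₄ →
  inBasis S t Q c₁ c₂ c₃ c₄ ≡ inBasis S t Q d₁ d₂ d₃ d₄
inBasis-cong S t Q refl refl refl refl = refl

centredSquare-inBasis : ∀ S t Q a κ qi →
  sq (1ℚ + (half * S + a * t)) + κ * (Q + t * qi * t) ≡ inBasis S t Q 1ℚ a (a * a + κ * qi) κ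
centredSquare-inBasis = solve 6 (λ S t Q a κ qi →
  sqₚ (con 1ℚ :+ (con half :* S :+ a :* t)) :+ κ :* (Q :+ t :* qi :* t)
  := con 1ℚ :* sqₚ (con 1ℚ :+ con half :* S) :+ a :* (t :* (con two :+ S)) :+ (a :* a :+ κ :* qi) :* (t :* t) :+ κ :* Q) refl
  where
  open ℚ-Solver.+-*-Solver
  sqₚ : Polynomial 6 → Polynomial 6
  sqₚ u = u :* u

even-balance : ∀ (ν w₊ w₋ c₀ a κ qi : ℚ) →
  ν * (two * w₊) + w₋ + four * c₀ ≡ 1ℚ → ν * (two * w₊) ≡ a + w₋ →
  ν * (two * w₊) + w₋ ≡ a * a + κ * qi → two * w₊ + c₀ ≡ κ → ∀ S t Q →
  (ν * (two * w₊ * sq (1ℚ + (half * S + 1ℚ * t))) + two * w₊ * Q)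
    + ((w₋ * sq (1ℚ + (half * S + - 1ℚ * t)) + 0ℚ) + c₀ * cubeMoment 1ℚ S Q)
  ≡ sq (1ℚ + (half * S + a * t)) + κ * (Q + t * qi * t)
even-balance ν w₊ w₋ c₀ a κ qi constant linear quadratic sumOfSquares S t Q = begin
  _ ≡⟨ expand ν w₊ w₋ c₀ S t Q ⟩
  inBasis S t Q (ν * (two * w₊) + w₋ + four * c₀) (ν * (two * w₊) + - w₋) (ν * (two * w₊) + w₋) (two * w₊ + c₀)
    ≡⟨ inBasis-cong S t Q constant (trans (cong (_+ - w₋) linear) (cancel a w₋)) quadratic sumOfSquares ⟩
  inBasis S t Q 1ℚ a (a * a + κ * qi) κ ≡⟨ centredSquare-inBasis S t Q a κ qi ⟨
  sq (1ℚ + (half * S + a * t)) + κ * (Q + t * qi * t) ∎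
  where
  open ℚ-Solver.+-*-Solver
  sqₚ : Polynomial 7 → Polynomial 7
  sqₚ u = u :* u
  expand : ∀ ν w₊ w₋ c₀ S t Q →
    (ν * (two * w₊ * sq (1ℚ + (half * S + 1ℚ * t))) + two * w₊ * Q)
      + ((w₋ * sq (1ℚ + (half * S + - 1ℚ * t)) + 0ℚ) + c₀ * cubeMoment 1ℚ S Q)
    ≡ inBasis S t Q (ν * (two * w₊) + w₋ + four * c₀) (ν * (two * w₊) + - w₋) (ν * (two * w₊) + w₋) (two * w₊ + c₀)
  expand = solve 7 (λ ν w₊ w₋ c₀ S t Q →
    (ν :* (con two :* w₊ :* sqₚ (con 1ℚ :+ (con half :* S :+ con 1ℚ :* t))) :+ con two :* w₊ :* Q)
      :+ ((w₋ :* sqₚ (con 1ℚ :+ (con half :* S :+ con (- 1ℚ) :* t)) :+ con 0ℚ)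
      :+ c₀ :* (con four :* (con 1ℚ :* con 1ℚ) :+ con four :* (con 1ℚ :* S) :+ (S :* S :+ Q)))
    := (ν :* (con two :* w₊) :+ w₋ :+ con four :* c₀) :* sqₚ (con 1ℚ :+ con half :* S)
       :+ (ν :* (con two :* w₊) :+ :- w₋) :* (t :* (con two :+ S))
       :+ (ν :* (con two :* w₊) :+ w₋) :* (t :* t) :+ (con two :* w₊ :+ c₀) :* Q) refl
  cancel : ∀ a w → a + w + - w ≡ a
  cancel a w = trans (ℚ.+-assoc a w (- w)) (trans (cong (_+_ a) (ℚ.+-inverseʳ w)) (ℚ.+-identityʳ a))

odd-balance : ∀ (ν w c₀ κ qi : ℚ) →
  ν * (four * w) + four * c₀ ≡ 1ℚ → ν * (four * w) ≡ κ * qi → four * w + c₀ ≡ κ → ∀ S t Q →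
  (ν * (two * w * sq (1ℚ + (half * S + 1ℚ * t)) + two * w * sq (1ℚ + (half * S + - 1ℚ * t))) + two * (w + w) * Q)
    + c₀ * cubeMoment 1ℚ S Q
  ≡ sq (1ℚ + (half * S + 0ℚ * t)) + κ * (Q + t * qi * t)
odd-balance ν w c₀ κ qi constant quadratic sumOfSquares S t Q = begin
  _ ≡⟨ expand ν w c₀ S t Q ⟩
  inBasis S t Q (ν * (four * w) + four * c₀) 0ℚ (ν * (four * w)) (four * w + c₀)
    ≡⟨ inBasis-cong S t Q constant (refl {x = 0ℚ}) (trans quadratic (sym (ℚ.+-identityˡ (κ * qi)))) sumOfSquares ⟩
  inBasis S t Q 1ℚ 0ℚ (0ℚ * 0ℚ + κ * qi) κ ≡⟨ centredSquare-inBasis S t Q 0ℚ κ qi ⟨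
  sq (1ℚ + (half * S + 0ℚ * t)) + κ * (Q + t * qi * t) ∎
  where
  open ℚ-Solver.+-*-Solver
  sqₚ : Polynomial 6 → Polynomial 6
  sqₚ u = u :* u
  expand : ∀ ν w c₀ S t Q →
    (ν * (two * w * sq (1ℚ + (half * S + 1ℚ * t)) + two * w * sq (1ℚ + (half * S + - 1ℚ * t))) + two * (w + w) * Q)
      + c₀ * cubeMoment 1ℚ S Q
    ≡ inBasis S t Q (ν * (four * w) + four * c₀) 0ℚ (ν * (four * w)) (four * w + c₀)
  expand = solve 6 (λ ν w c₀ S t Q →
    (ν :* (con two :* w :* sqₚ (con 1ℚ :+ (con half :* S :+ con 1ℚ :* t)) :+ con two :* w :* sqₚ (con 1ℚ :+ (con half :* S :+ con (- 1ℚ) :* t)))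
      :+ con two :* (w :+ w) :* Q)
      :+ c₀ :* (con four :* (con 1ℚ :* con 1ℚ) :+ con four :* (con 1ℚ :* S) :+ (S :* S :+ Q))
    := (ν :* (con four :* w) :+ con four :* c₀) :* sqₚ (con 1ℚ :+ con half :* S) :+ con 0ℚ :* (t :* (con two :+ S))
       :+ ν :* (con four :* w) :* (t :* t) :+ (con four :* w :+ c₀) :* Q) refl

PositiveCombination : ∀ {n} → List (Vec n) → QF n → Set
PositiveCombination {n} L g =
  Σ (Fin (length L) → ℚ) (λ α →
    ((v : Fin (length L)) → 0ℚ < α v) ×
    ((y : Vec n) → Σℚ (map (λ v → α v * ev (lookup L v) y) (allFin (length L))) ≡ g y))

positiveCombination : ∀ {n} (L : List (Vec n)) {g : QF n} (w : Vec n → ℚ) → (∀ v → Positive (w v)) →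
  (∀ y → Σℚ (map (λ v → w v * ev v y) L) ≡ g y) → PositiveCombination L g
positiveCombination L w pos represents =
  w ∘ lookup L , (λ v → positive⁻¹ (w (lookup L v)) {{pos (lookup L v)}}) ,
  λ y → trans (Σℚ-lookup (λ v → w v * ev v y) L) (represents y)

target : ∀ n → QF n
target n y = ev (centre n) y + (μ n * frac (+ 1) n) * matQF (QinvMat n) y

by-parity : ∀ n {b} {x x′ : A} → isEven n ≡ b → (if isEven n then x else x′) ≡ (if b then x else x′)
by-parity n {x = x} {x′} parity = cong (if_then x else x′) parity

-- The weights are rational functions of k = n − 6 (the variable X); q = 1/n and r = 1/(n − 3).
module EvenDimension (k : ℕ) where

  q r κ qi w₊ w₋ c₀ : RatFun
  q  = 1/1+ (# 5 ⊞ X)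
  r  = 1/1+ (# 2 ⊞ X)
  κ  = ((# 4 ⊞ X) ⊠ (# 4 ⊞ X)) /1+ (# 11 ⊞ # 4 ⊠ X) ⊗ q
  qi = # 4 /1+ (# 2 ⊞ X)
  w₊ = ` (# 4 ⊞ X) ⊗ 1/1+ # 1 ⊗ q ⊗ r ⊗ r
  w₋ = ` # 2 ⊗ q ⊗ r ⊗ r
  c₀ = ` ((# 4 ⊞ X) ⊠ (# 8 ⊞ # 7 ⊠ X ⊞ X ⊠ X)) ⊗ 1/1+ # 3 ⊗ q ⊗ r ⊗ r

  constant : ` (# 5 ⊞ X) ⊗ (` # 2 ⊗ w₊) ⊕ w₋ ⊕ ` # 4 ⊗ c₀ ≐ ` # 1
  constant = ≐-by-normalisation refl

  linear : ` (# 5 ⊞ X) ⊗ (` # 2 ⊗ w₊) ≐ r ⊕ w₋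
  linear = ≐-by-normalisation refl

  quadratic : ` (# 5 ⊞ X) ⊗ (` # 2 ⊗ w₊) ⊕ w₋ ≐ r ⊗ r ⊕ κ ⊗ qi
  quadratic = ≐-by-normalisation refl

  sumOfSquares : ` # 2 ⊗ w₊ ⊕ c₀ ≐ κ
  sumOfSquares = ≐-by-normalisation refl

  n : ℕ
  n = 6 ℕ.+ k

  w₀ : ℚ
  w₀ = eval c₀ k * half ^ (2 ℕ.+ k)

  weight : Vec n → ℚ
  weight v = layerWeight (eval w₊ k) (eval w₋ k) w₀ (v (fromℕ (5 ℕ.+ k)))

  weight-pos : ∀ v → Positive (weight v)
  weight-pos v = layerWeight-pos (eval-pos w₊ k _) (eval-pos w₋ k _)
    (pos*pos⇒pos (eval c₀ k) {{eval-pos c₀ k _}} (half ^ (2 ℕ.+ k)) {{half^-pos (2 ℕ.+ k)}}) (v (fromℕ (5 ℕ.+ k)))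

  module _ (parity : isEven n ≡ true) (y : Vec n) where
    open Coordinates y
    open VertexSums y (eval w₊ k) (eval w₋ k) w₀

    target-even : target n y ≡ sq (1ℚ + (half * S + eval r k * t)) + eval κ k * (Q + t * eval qi k * t)
    target-even = cong₂ _+_
      (trans (cong (λ c → ev c y) (by-parity n parity)) (cong (λ d → sq (1ℚ + d)) (dot-halfPt (eval r k))))
      (cong₂ _*_ (cong (_* frac (+ 1) n)
                   (trans (by-parity n parity) (cong (frac (+ ((4 ℕ.+ k) ℕ.* (4 ℕ.+ k)))) (ℕₚ.*-distribˡ-+ 4 3 k))))
                 (trans matQF-QinvMat (cong (λ u → Q + t * u * t) (by-parity n parity))))

    represents : Σℚ (map weighted (verts n)) ≡ target n y
    represents = begin
      Σℚ (map weighted (verts n))      ≡⟨ cong (Σℚ ∘ map weighted) (by-parity n parity) ⟩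
      Σℚ (map weighted (vertsEven n))  ≡⟨ evenVertices-sum ⟩
      upper + (lower + w₀ * squareSum evenBits (5 ℕ.+ k) 1ℚ z)
        ≡⟨ cong (λ u → upper + (lower + u)) (halfCube-weighted (2 ℕ.+ k) (eval c₀ k) z) ⟩
      upper + (lower + eval c₀ k * cubeMoment 1ℚ S Q)
        ≡⟨ even-balance (toℚ (5 ℕ.+ k)) (eval w₊ k) (eval w₋ k) (eval c₀ k) (eval r k) (eval κ k) (eval qi k)
             (constant .pointwise k) (linear .pointwise k) (quadratic .pointwise k) (sumOfSquares .pointwise k) S t Q ⟩
      sq (1ℚ + (half * S + eval r k * t)) + eval κ k * (Q + t * eval qi k * t) ≡⟨ target-even ⟨
      target n y ∎
      where
      upper lower : ℚ
      upper = toℚ (5 ℕ.+ k) * (two * eval w₊ k * sq (1ℚ + (half * S + 1ℚ * t))) + two * eval w₊ k * Q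
      lower = eval w₋ k * sq (1ℚ + (half * S + - 1ℚ * t)) + 0ℚ

  eutactic : isEven n ≡ true → PositiveCombination (verts n) (target n)
  eutactic parity = positiveCombination (verts n) weight weight-pos (represents parity)

-- As above, with s = 1/(n − 5).
module OddDimension (k : ℕ) where

  q s κ qi w c₀ : RatFun
  q  = 1/1+ (# 5 ⊞ X)
  s  = 1/1+ X
  κ  = (# 5 ⊞ X) /1+ # 3 ⊗ q
  qi = # 4 /1+ X
  w  = 1/1+ # 3 ⊗ q ⊗ s
  c₀ = ` (# 1 ⊞ # 6 ⊠ X ⊞ X ⊠ X) ⊗ 1/1+ # 3 ⊗ q ⊗ s

  constant : ` (# 5 ⊞ X) ⊗ (` # 4 ⊗ w) ⊕ ` # 4 ⊗ c₀ ≐ ` # 1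
  constant = ≐-by-normalisation refl

  quadratic : ` (# 5 ⊞ X) ⊗ (` # 4 ⊗ w) ≐ κ ⊗ qi
  quadratic = ≐-by-normalisation refl

  sumOfSquares : ` # 4 ⊗ w ⊕ c₀ ≐ κ
  sumOfSquares = ≐-by-normalisation refl

  n : ℕ
  n = 6 ℕ.+ k

  w₀ : ℚ
  w₀ = eval c₀ k * half ^ (2 ℕ.+ k)

  weight : Vec n → ℚ
  weight v = layerWeight (eval w k) (eval w k) w₀ (v (fromℕ (5 ℕ.+ k)))

  weight-pos : ∀ v → Positive (weight v)
  weight-pos v = layerWeight-pos (eval-pos w k _) (eval-pos w k _)
    (pos*pos⇒pos (eval c₀ k) {{eval-pos c₀ k _}} (half ^ (2 ℕ.+ k)) {{half^-pos (2 ℕ.+ k)}}) (v (fromℕ (5 ℕ.+ k)))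

  module _ (parity : isEven n ≡ false) (y : Vec n) where
    open Coordinates y
    open VertexSums y (eval w k) (eval w k) w₀

    target-odd : target n y ≡ sq (1ℚ + (half * S + 0ℚ * t)) + eval κ k * (Q + t * eval qi k * t)
    target-odd = cong₂ _+_
      (trans (cong (λ c → ev c y) (by-parity n parity)) (cong (λ d → sq (1ℚ + d)) (dot-halfPt 0ℚ)))
      (cong₂ _*_ (cong (_* frac (+ 1) n) (by-parity n parity))
                 (trans matQF-QinvMat (cong (λ u → Q + t * u * t) (by-parity n parity))))

    represents : Σℚ (map weighted (verts n)) ≡ target n y
    represents = begin
      Σℚ (map weighted (verts n))     ≡⟨ cong (Σℚ ∘ map weighted) (by-parity n parity) ⟩
      Σℚ (map weighted (vertsOdd n))  ≡⟨ oddVertices-sum ⟩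
      upper + w₀ * squareSum evenBits (5 ℕ.+ k) 1ℚ z ≡⟨ cong (_+_ upper) (halfCube-weighted (2 ℕ.+ k) (eval c₀ k) z) ⟩
      upper + eval c₀ k * cubeMoment 1ℚ S Q
        ≡⟨ odd-balance (toℚ (5 ℕ.+ k)) (eval w k) (eval c₀ k) (eval κ k) (eval qi k)
             (constant .pointwise k) (quadratic .pointwise k) (sumOfSquares .pointwise k) S t Q ⟩
      sq (1ℚ + (half * S + 0ℚ * t)) + eval κ k * (Q + t * eval qi k * t) ≡⟨ target-odd ⟨
      target n y ∎
      where
      upper : ℚ
      upper = toℚ (5 ℕ.+ k) * (two * eval w k * sq (1ℚ + (half * S + 1ℚ * t)) + two * eval w k * sq (1ℚ + (half * S + - 1ℚ * t)))
              + two * (eval w k + eval w k) * Q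

  eutactic : isEven n ≡ false → PositiveCombination (verts n) (target n)
  eutactic parity = positiveCombination (verts n) weight weight-pos (represents parity)

lemma7p2 : (n : ℕ) → 6 ≤ n →
    Σ (Fin (length (verts n)) → ℚ) (λ α →
      ((v : Fin (length (verts n))) → 0ℚ < α v) ×
      ((y : Vec n) →
        Σℚ (map (λ v → α v * ev (lookup (verts n) v) y) (allFin (length (verts n))))
          ≡ ev (centre n) y + (μ n * frac (+ 1) n) * matQF (QinvMat n) y))
lemma7p2 (suc (suc (suc (suc (suc (suc k)))))) (s≤s (s≤s (s≤s (s≤s (s≤s (s≤s z≤n)))))) = byParity (isEven (6 ℕ.+ k)) refl
  where
  byParity : ∀ b → isEven (6 ℕ.+ k) ≡ b → PositiveCombination (verts (6 ℕ.+ k)) (target (6 ℕ.+ k))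
  byParity true  = EvenDimension.eutactic k
  byParity false = OddDimension.eutactic k
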